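{- Let $k\in\mathbb{Z}^+$, let $n\ge 2k+1$, and fix distinct $i,j\in[n]$. For distinct $x,y\in[n]\setminus\{i,j\}$, the number of permutations $\pi\in\mathcal{S}_n$ satisfying $\pi^k(i)=x$ and $\pi^k(j)=y$ does not depend on the choice of $x$ and $y$.
   Context: $\mathcal{S}_n$ is the symmetric group on $[n]=\{1,\dots,n\}$. -}

module Defs where

open import Data.Nat using (ℕ; zero; suc)
open import Data.Fin using (Fin; _≟_)
open import Data.Fin.Properties using (any?)
open import Data.List using (List; []; _∷_; concatMap; map; filter; length; allFin)
open import Data.Vec using (Vec; []; _∷_; lookup; toList)
open import Data.List.Relation.Unary.Unique.Propositional using (Unique)
import Data.List.Relation.Unary.Unique.DecPropositional as UDec
open import Data.Product using (_×_)
open import Relation.Binary.PropositionalEquality using (_≡_)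
open import Relation.Nullary using (Dec; _×-dec_)

allVecs : (m n : ℕ) → List (Vec (Fin n) m)
allVecs zero    n = [] ∷ []
allVecs (suc m) n = concatMap (λ a → map (a ∷_) (allVecs m n)) (allFin n)

-- A map Fin n → Fin n (as its table of values) is a permutation iff it is injective,
-- i.e. its list of values has no repetitions.
IsPerm : ∀ {n} → Vec (Fin n) n → Set
IsPerm v = Unique (toList v)

isPerm? : ∀ {n} (v : Vec (Fin n) n) → Dec (IsPerm v)
isPerm? {n} v = UDec.unique? _≟_ (toList v)

-- The symmetric group S_n, enumerated as a list (each permutation exactly once),
-- a permutation π being represented by its table  (π(0), …, π(n-1)).
Sym : (n : ℕ) → List (Vec (Fin n) n)
Sym n = filter isPerm? (allVecs n n)

apply : ∀ {n} → Vec (Fin n) n → Fin n → Fin n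
apply v i = lookup v i

iter : ∀ {n} → ℕ → Vec (Fin n) n → Fin n → Fin n
iter zero    v i = i
iter (suc k) v i = apply v (iter k v i)

count : (n k : ℕ) (i j x y : Fin n) → ℕ
count n k i j x y =
  length (filter (λ π → (iter k π i ≟ x) ×-dec (iter k π j ≟ y)) (Sym n))

-- Conjugation π ↦ σ π σ⁻¹ is a bijection of S_n with (σπσ⁻¹)^k (σ a) = σ (π^k a), so it
-- turns the permutations with π^k(i) = x, π^k(j) = y into those with
-- π^k(σ i) = σ x, π^k(σ j) = σ y.  Composing two transpositions gives a σ fixing i and j
-- that sends (x, y) to any other pair (x′, y′) of distinct points outside {i, j}.
module Submission where

open import Defs
open import Data.Nat using (ℕ; suc; _≤_; _+_; _*_)
open import Data.Fin using (Fin)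
open import Relation.Binary.PropositionalEquality using (_≡_; _≢_)

open import Data.Nat using (zero)
open import Data.Fin using (_≟_)
open import Data.Fin.Permutation
  using (Permutation; Permutation′; _⟨$⟩ʳ_; _⟨$⟩ˡ_; inverseˡ; flip; transpose; _∘ₚ_)
open import Data.List using (List; []; _∷_; map; filter; length; allFin; concatMap; cartesianProductWith; _++_)
open import Data.List.Properties using (length-map; filter-≐)
open import Data.List.Membership.Propositional using (_∈_)
open import Data.List.Membership.Propositional.Properties
  using (∈-map⁺; ∈-map⁻; ∈-filter⁺; ∈-filter⁻; ∈-allFin; ∈-cartesianProductWith⁺)
open import Data.List.Membership.Propositional.Properties.WithK using (unique∧set⇒bag)
open import Data.List.Relation.Binary.BagAndSetEquality using (∼bag⇒↭)
open import Data.List.Relation.Binary.Permutation.Propositional using (_↭_)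
open import Data.List.Relation.Binary.Permutation.Propositional.Properties using (filter-↭; ↭-length)
open import Data.List.Relation.Unary.All using ([]; _∷_)
open import Data.List.Relation.Unary.AllPairs using ([]; _∷_)
open import Data.List.Relation.Unary.Any using (here)
open import Data.List.Relation.Unary.Unique.Propositional using (Unique)
open import Data.List.Relation.Unary.Unique.Propositional.Properties
  using (map⁺; filter⁺; allFin⁺; cartesianProductWith⁺)
open import Data.Product using (Σ-syntax; _×_; _,_; proj₂)
open import Data.Vec using (Vec; []; _∷_; lookup; toList; tabulate)
open import Data.Vec.Properties using (∷-injective; lookup∘tabulate; tabulate∘lookup; tabulate-cong)
import Data.Vec.Relation.Unary.All.Properties as VecAll
open import Data.Vec.Relation.Unary.AllPairs using ([]; _∷_)
open import Data.Vec.Relation.Unary.Unique.Propositional using () renaming (Unique to VecUnique)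
open import Data.Vec.Relation.Unary.Unique.Propositional.Properties using (tabulate⁺; lookup-injective)
open import Function using (_∘_; _↔_; Inverse; mk↔ₛ′; mk⇔)
open import Function.Definitions using (Injective)
open import Function.Bundles using (Injection)
open import Function.Properties.Inverse using (↔⇒↣)
open import Relation.Binary.PropositionalEquality using (refl; sym; trans; cong; cong₂; subst; module ≡-Reasoning)
open import Relation.Nullary using (yes; no; _×-dec_)
open import Relation.Nullary.Decidable using (dec-true; dec-false)
open import Level using (0ℓ)
open import Relation.Unary using (Pred; Decidable)

private
  variable
    m n : ℕ

filter-map : ∀ {A B : Set} {p} {P : Pred B p} (P? : Decidable P) (f : A → B) (xs : List A) →
             filter P? (map f xs) ≡ map f (filter (P? ∘ f) xs)
filter-map P? f []       = refl
filter-map P? f (x ∷ xs) with P? (f x)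
... | yes _ = cong (f x ∷_) (filter-map P? f xs)
... | no  _ = filter-map P? f xs

map-↭ : ∀ {A : Set} {xs : List A} → Unique xs → (f : A ↔ A) →
        (∀ {x} → x ∈ xs → Inverse.to f x ∈ xs) → (∀ {x} → x ∈ xs → Inverse.from f x ∈ xs) →
        map (Inverse.to f) xs ↭ xs
map-↭ {xs = xs} xs! f to-closed from-closed =
  ∼bag⇒↭ (unique∧set⇒bag (map⁺ (Injection.injective (↔⇒↣ f)) xs!) xs! (mk⇔ into onto))
  where
  open Inverse f
  into : ∀ {y} → y ∈ map to xs → y ∈ xs
  into y∈ with x , x∈ , refl ← ∈-map⁻ to y∈ = to-closed x∈
  onto : ∀ {y} → y ∈ xs → y ∈ map to xs
  onto {y} y∈ = subst (_∈ map to xs) (strictlyInverseˡ y) (∈-map⁺ to (from-closed y∈))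

length-filter-↔ : ∀ {A : Set} {p} {P : Pred A p} (P? : Decidable P) {xs : List A} → Unique xs → (f : A ↔ A) →
                  (∀ {x} → x ∈ xs → Inverse.to f x ∈ xs) → (∀ {x} → x ∈ xs → Inverse.from f x ∈ xs) →
                  length (filter (P? ∘ Inverse.to f) xs) ≡ length (filter P? xs)
length-filter-↔ P? {xs} xs! f to-closed from-closed = begin
  length (filter (P? ∘ to) xs)         ≡⟨ length-map to (filter (P? ∘ to) xs) ⟨
  length (map to (filter (P? ∘ to) xs)) ≡⟨ cong length (filter-map P? to xs) ⟨
  length (filter P? (map to xs))       ≡⟨ ↭-length (filter-↭ P? (map-↭ xs! f to-closed from-closed)) ⟩
  length (filter P? xs)                ∎
  where open Inverse f; open ≡-Reasoning

concatMap-map≡cartesianProductWith : ∀ {A B C : Set} (f : A → B → C) (xs : List A) (ys : List B) →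
                                     concatMap (λ x → map (f x) ys) xs ≡ cartesianProductWith f xs ys
concatMap-map≡cartesianProductWith f []       ys = refl
concatMap-map≡cartesianProductWith f (x ∷ xs) ys =
  cong (map (f x) ys ++_) (concatMap-map≡cartesianProductWith f xs ys)

allVecs-suc : ∀ m n → allVecs (suc m) n ≡ cartesianProductWith _∷_ (allFin n) (allVecs m n)
allVecs-suc m n = concatMap-map≡cartesianProductWith _∷_ (allFin n) (allVecs m n)

∈-allVecs : (v : Vec (Fin n) m) → v ∈ allVecs m n
∈-allVecs []                  = here refl
∈-allVecs {n} {suc m} (a ∷ v) =
  subst (a ∷ v ∈_) (sym (allVecs-suc m n)) (∈-cartesianProductWith⁺ _∷_ (∈-allFin a) (∈-allVecs v))

allVecs-unique : ∀ m n → Unique (allVecs m n)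
allVecs-unique zero    n = [] ∷ []
allVecs-unique (suc m) n =
  subst Unique (sym (allVecs-suc m n)) (cartesianProductWith⁺ _∷_ ∷-injective (allFin⁺ n) (allVecs-unique m n))

Sym-unique : ∀ n → Unique (Sym n)
Sym-unique n = filter⁺ isPerm? (allVecs-unique n n)

∈-Sym⁺ : {π : Vec (Fin n) n} → IsPerm π → π ∈ Sym n
∈-Sym⁺ {π = π} π! = ∈-filter⁺ isPerm? (∈-allVecs π) π!

∈-Sym⁻ : {π : Vec (Fin n) n} → π ∈ Sym n → IsPerm π
∈-Sym⁻ {n} π∈ = proj₂ (∈-filter⁻ isPerm? {xs = allVecs n n} π∈)

Unique-toList⁺ : {v : Vec (Fin n) m} → VecUnique v → Unique (toList v)
Unique-toList⁺ []        = []
Unique-toList⁺ (a∉ ∷ v!) = VecAll.toList⁺ a∉ ∷ Unique-toList⁺ v!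

Unique-toList⁻ : {v : Vec (Fin n) m} → Unique (toList v) → VecUnique v
Unique-toList⁻ {v = []}    []        = []
Unique-toList⁻ {v = _ ∷ _} (a∉ ∷ v!) = VecAll.toList⁻ a∉ ∷ Unique-toList⁻ v!

⟨$⟩ʳ-injective : (σ : Permutation m n) → Injective _≡_ _≡_ (σ ⟨$⟩ʳ_)
⟨$⟩ʳ-injective σ = Injection.injective (↔⇒↣ σ)

conj : Permutation′ n → Vec (Fin n) n → Vec (Fin n) n
conj σ π = tabulate (λ a → σ ⟨$⟩ʳ lookup π (σ ⟨$⟩ˡ a))

module _ (σ : Permutation′ n) where
  open ≡-Reasoning

  lookup-conj : ∀ π a → lookup (conj σ π) a ≡ σ ⟨$⟩ʳ lookup π (σ ⟨$⟩ˡ a)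
  lookup-conj π a = lookup∘tabulate _ a

  conj-flip : ∀ π → conj (flip σ) (conj σ π) ≡ π
  conj-flip π = begin
    tabulate (λ a → σ ⟨$⟩ˡ lookup (conj σ π) (σ ⟨$⟩ʳ a)) ≡⟨ tabulate-cong cancel ⟩
    tabulate (lookup π)                                 ≡⟨ tabulate∘lookup π ⟩
    π                                                   ∎
    where
    cancel : ∀ a → σ ⟨$⟩ˡ lookup (conj σ π) (σ ⟨$⟩ʳ a) ≡ lookup π a
    cancel a = begin
      σ ⟨$⟩ˡ lookup (conj σ π) (σ ⟨$⟩ʳ a)            ≡⟨ cong (σ ⟨$⟩ˡ_) (lookup-conj π (σ ⟨$⟩ʳ a)) ⟩
      σ ⟨$⟩ˡ (σ ⟨$⟩ʳ lookup π (σ ⟨$⟩ˡ (σ ⟨$⟩ʳ a))) ≡⟨ inverseˡ σ ⟩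
      lookup π (σ ⟨$⟩ˡ (σ ⟨$⟩ʳ a))                 ≡⟨ cong (lookup π) (inverseˡ σ) ⟩
      lookup π a                                    ∎

  iter-conj : ∀ k π a → iter k (conj σ π) (σ ⟨$⟩ʳ a) ≡ σ ⟨$⟩ʳ iter k π a
  iter-conj zero    π a = refl
  iter-conj (suc k) π a = begin
    lookup (conj σ π) (iter k (conj σ π) (σ ⟨$⟩ʳ a)) ≡⟨ cong (lookup (conj σ π)) (iter-conj k π a) ⟩
    lookup (conj σ π) (σ ⟨$⟩ʳ iter k π a)           ≡⟨ lookup-conj π _ ⟩
    σ ⟨$⟩ʳ lookup π (σ ⟨$⟩ˡ (σ ⟨$⟩ʳ iter k π a))   ≡⟨ cong (λ b → σ ⟨$⟩ʳ lookup π b) (inverseˡ σ) ⟩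
    σ ⟨$⟩ʳ lookup π (iter k π a)                     ∎

  conj-IsPerm : ∀ {π} → IsPerm π → IsPerm (conj σ π)
  conj-IsPerm π! = Unique-toList⁺ (tabulate⁺ (⟨$⟩ʳ-injective (flip σ)
    ∘ lookup-injective (Unique-toList⁻ π!) _ _ ∘ ⟨$⟩ʳ-injective σ))

  conj-∈-Sym : ∀ {π} → π ∈ Sym n → conj σ π ∈ Sym n
  conj-∈-Sym = ∈-Sym⁺ ∘ conj-IsPerm ∘ ∈-Sym⁻

conj-↔ : Permutation′ n → Vec (Fin n) n ↔ Vec (Fin n) n
conj-↔ σ = mk↔ₛ′ (conj σ) (conj (flip σ)) (conj-flip (flip σ)) (conj-flip σ)

Reaches : ℕ → (i j x y : Fin n) → Pred (Vec (Fin n) n) 0ℓ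
Reaches k i j x y π = iter k π i ≡ x × iter k π j ≡ y

reaches? : ∀ k (i j x y : Fin n) → Decidable (Reaches k i j x y)
reaches? k i j x y π = (iter k π i ≟ x) ×-dec (iter k π j ≟ y)

count-conj : ∀ n k (σ : Permutation′ n) (i j x y : Fin n) →
             count n k (σ ⟨$⟩ʳ i) (σ ⟨$⟩ʳ j) (σ ⟨$⟩ʳ x) (σ ⟨$⟩ʳ y) ≡ count n k i j x y
count-conj n k σ i j x y = begin
  length (filter (reaches? k (σ ⟨$⟩ʳ i) (σ ⟨$⟩ʳ j) (σ ⟨$⟩ʳ x) (σ ⟨$⟩ʳ y)) (Sym n))
    ≡⟨ length-filter-↔ (reaches? k _ _ _ _) (Sym-unique n) (conj-↔ σ) (conj-∈-Sym σ) (conj-∈-Sym (flip σ)) ⟨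
  length (filter (reaches? k (σ ⟨$⟩ʳ i) (σ ⟨$⟩ʳ j) (σ ⟨$⟩ʳ x) (σ ⟨$⟩ʳ y) ∘ conj σ) (Sym n))
    ≡⟨ cong length (filter-≐ _ (reaches? k i j x y) (unconj , reconj) (Sym n)) ⟩
  length (filter (reaches? k i j x y) (Sym n))
    ∎
  where
  open ≡-Reasoning
  unconj : ∀ {π} → Reaches k (σ ⟨$⟩ʳ i) (σ ⟨$⟩ʳ j) (σ ⟨$⟩ʳ x) (σ ⟨$⟩ʳ y) (conj σ π) → Reaches k i j x y π
  unconj {π} (πi , πj) = ⟨$⟩ʳ-injective σ (trans (sym (iter-conj σ k π i)) πi)
                       , ⟨$⟩ʳ-injective σ (trans (sym (iter-conj σ k π j)) πj)
  reconj : ∀ {π} → Reaches k i j x y π → Reaches k (σ ⟨$⟩ʳ i) (σ ⟨$⟩ʳ j) (σ ⟨$⟩ʳ x) (σ ⟨$⟩ʳ y) (conj σ π)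
  reconj {π} (πi , πj) = trans (iter-conj σ k π i) (cong (σ ⟨$⟩ʳ_) πi)
                       , trans (iter-conj σ k π j) (cong (σ ⟨$⟩ʳ_) πj)

transpose-matchˡ : (a b : Fin n) → transpose a b ⟨$⟩ʳ a ≡ b
transpose-matchˡ a b rewrite dec-true (a ≟ a) refl = refl

transpose-mismatch : {a b c : Fin n} → a ≢ c → b ≢ c → transpose a b ⟨$⟩ʳ c ≡ c
transpose-mismatch {a = a} {b} {c} a≢c b≢c
  rewrite dec-false (c ≟ a) (a≢c ∘ sym) | dec-false (c ≟ b) (b≢c ∘ sym) = refl

pair-transitive : {x y x′ y′ : Fin n} → x ≢ y → x′ ≢ y′ →
  Σ[ σ ∈ Permutation′ n ] σ ⟨$⟩ʳ x ≡ x′ × σ ⟨$⟩ʳ y ≡ y′ ×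
                          (∀ c → x ≢ c → y ≢ c → x′ ≢ c → y′ ≢ c → σ ⟨$⟩ʳ c ≡ c)
pair-transitive {x = x} {y} {x′} {y′} x≢y x′≢y′ = τ ∘ₚ τ′ , σx≡x′ , transpose-matchˡ u y′ , σ-fixes
  where
  τ = transpose x x′
  u = τ ⟨$⟩ʳ y
  τ′ = transpose u y′
  τx≡x′ : τ ⟨$⟩ʳ x ≡ x′
  τx≡x′ = transpose-matchˡ x x′
  u≢x′ : u ≢ x′
  u≢x′ u≡x′ = x≢y (⟨$⟩ʳ-injective τ (trans τx≡x′ (sym u≡x′)))
  σx≡x′ : τ′ ⟨$⟩ʳ (τ ⟨$⟩ʳ x) ≡ x′
  σx≡x′ = trans (cong (τ′ ⟨$⟩ʳ_) τx≡x′) (transpose-mismatch u≢x′ (x′≢y′ ∘ sym))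
  σ-fixes : ∀ c → x ≢ c → y ≢ c → x′ ≢ c → y′ ≢ c → τ′ ⟨$⟩ʳ (τ ⟨$⟩ʳ c) ≡ c
  σ-fixes c x≢c y≢c x′≢c y′≢c = trans (cong (τ′ ⟨$⟩ʳ_) τc≡c) (transpose-mismatch u≢c y′≢c)
    where
    τc≡c : τ ⟨$⟩ʳ c ≡ c
    τc≡c = transpose-mismatch x≢c x′≢c
    u≢c : u ≢ c
    u≢c u≡c = y≢c (⟨$⟩ʳ-injective τ (trans u≡c (sym τc≡c)))

lemma2p1 : (k n : ℕ) → 1 ≤ k → 2 * k + 1 ≤ n → (i j : Fin n) → i ≢ j →
    (x y x′ y′ : Fin n) →
    x ≢ y → x ≢ i → x ≢ j → y ≢ i → y ≢ j →
    x′ ≢ y′ → x′ ≢ i → x′ ≢ j → y′ ≢ i → y′ ≢ j →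
    count n k i j x y ≡ count n k i j x′ y′
lemma2p1 k n _ _ i j _ x y x′ y′ x≢y x≢i x≢j y≢i y≢j x′≢y′ x′≢i x′≢j y′≢i y′≢j
  with σ , σx≡x′ , σy≡y′ , σ-fixes ← pair-transitive x≢y x′≢y′ = begin
  count n k i j x y
    ≡⟨ count-conj n k σ i j x y ⟨
  count n k (σ ⟨$⟩ʳ i) (σ ⟨$⟩ʳ j) (σ ⟨$⟩ʳ x) (σ ⟨$⟩ʳ y)
    ≡⟨ cong₂ (λ a b → count n k a b (σ ⟨$⟩ʳ x) (σ ⟨$⟩ʳ y)) (σ-fixes i x≢i y≢i x′≢i y′≢i) (σ-fixes j x≢j y≢j x′≢j y′≢j) ⟩
  count n k i j (σ ⟨$⟩ʳ x) (σ ⟨$⟩ʳ y)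
    ≡⟨ cong₂ (count n k i j) σx≡x′ σy≡y′ ⟩
  count n k i j x′ y′
    ∎
  where open ≡-Reasoning
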